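{- Let $G$ be a group given by a presentation $\langle X\mid R\rangle$, and let $U$ and $V$ be length-$\ell$ factorizations of elements of $G$ which are double reverses. Let $p_1,\ldots,p_n\in\{1,\ldots,\ell-1\}$. Let $U_n$ be the factorization obtained from $U$ by applying the Hurwitz moves $\sigma_{p_1},\sigma_{p_2},\ldots,\sigma_{p_n}$ in that order, and let $V_n$ be the factorization obtained from $V$ by applying the inverse Hurwitz moves $\sigma^{ -1}_{\ell-p_1},\sigma^{ -1}_{\ell-p_2},\ldots,\sigma^{ -1}_{\ell-p_n}$ in that order. Then $U_n$ and $V_n$ are double reverses.
   Context: $X=\{x_1,\ldots,x_n\}$, $F(X)$ is the free group on $X$ (reduced words on $X\cup X^{ -1}$), and $\langle X\mid R\rangle$ with $R\subset F(X)$ presents $G\cong F(X)/N$, $N$ the normal closure of $R$; each word in $F(X)$ represents an element of $G$. For $a=x_{i_1}\cdots x_{i_p}\in F(X)$ with letters in $X\cup X^{ -1}$, the reverse is $a^*=x_{i_p}\cdots x_{i_1}$. A factorization is a tuple of elements of $G$. Two length-$\ell$ factorizations $U,V$ are double reverses if there exist $a_1,\ldots,a_\ell\in F(X)$ with $U=(a_1,\ldots,a_\ell)$ and $V=(a_\ell^*,a_{\ell-1}^*,\ldots,a_1^*)$ (as tuples of elements of $G$). For $1\le i\le\ell-1$, the Hurwitz move $\sigma_i$ sends $(x_1,\ldots,x_i,x_{i+1},\ldots,x_\ell)$ to $(x_1,\ldots,x_{i+1},x_{i+1}^{ -1}x_ix_{i+1},\ldots,x_\ell)$ and $\sigma_i^{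 -1}$ sends it to $(x_1,\ldots,x_ix_{i+1}x_i^{ -1},x_i,\ldots,x_\ell)$, other entries unchanged. -}

module Defs where

open import Data.Nat using (ℕ; zero; suc)
open import Data.Fin using (Fin)
open import Data.Bool using (Bool; true; false; not)
open import Data.Product using (_×_; _,_; Σ)
open import Data.List using (List; []; _∷_; _++_; reverse; map; foldl)
open import Data.List.Relation.Binary.Pointwise using (Pointwise)

-- A letter of X ∪ X⁻¹ with X = {x_1,…,x_k}: (i , true) = x_i, (i , false) = x_i⁻¹.
Letter : ℕ → Set
Letter k = Fin k × Bool

Word : ℕ → Set
Word k = List (Letter k)

flipL : ∀ {k} → Letter k → Letter k
flipL (i , b) = (i , not b)

inv : ∀ {k} → Word k → Word k
inv w = reverse (map flipL w)

rev : ∀ {k} → Word k → Word k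
rev w = reverse w

-- Equality in G = F(X)/N, N the normal closure of the relators R:
-- the congruence on words generated by free cancellation and r = 1 (r ∈ R).
data _≈⟨_⟩_ {k : ℕ} : Word k → (Word k → Set) → Word k → Set₁ where
  ≈-refl   : ∀ {R u} → u ≈⟨ R ⟩ u
  ≈-sym    : ∀ {R u v} → u ≈⟨ R ⟩ v → v ≈⟨ R ⟩ u
  ≈-trans  : ∀ {R u v w} → u ≈⟨ R ⟩ v → v ≈⟨ R ⟩ w → u ≈⟨ R ⟩ w
  ≈-cong   : ∀ {R u u′ v v′} → u ≈⟨ R ⟩ u′ → v ≈⟨ R ⟩ v′ → (u ++ v) ≈⟨ R ⟩ (u′ ++ v′)
  ≈-cancel : ∀ {R} (a : Letter k) → (a ∷ flipL a ∷ []) ≈⟨ R ⟩ []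
  ≈-rel    : ∀ {R r} → R r → r ≈⟨ R ⟩ []

FactEq : ∀ {k} → (Word k → Set) → List (Word k) → List (Word k) → Set₁
FactEq R = Pointwise (λ u v → u ≈⟨ R ⟩ v)

DoubleReverse : ∀ {k} → (Word k → Set) → List (Word k) → List (Word k) → Set₁
DoubleReverse {k} R U V =
  Σ (List (Word k)) λ as → FactEq R U as × FactEq R V (reverse (map rev as))

-- Hurwitz move σ_i (positions 1-based; i = 1 acts on entries 1,2).
σ : ∀ {k} → ℕ → List (Word k) → List (Word k)
σ (suc zero) (x ∷ y ∷ rest) = y ∷ (inv y ++ x ++ y) ∷ rest
σ (suc (suc i)) (x ∷ rest) = x ∷ σ (suc i) rest
σ _ W = W

σ⁻¹ : ∀ {k} → ℕ → List (Word k) → List (Word k)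
σ⁻¹ (suc zero) (x ∷ y ∷ rest) = (x ++ y ++ inv x) ∷ x ∷ rest
σ⁻¹ (suc (suc i)) (x ∷ rest) = x ∷ σ⁻¹ (suc i) rest
σ⁻¹ _ W = W

applyσ : ∀ {k} → List ℕ → List (Word k) → List (Word k)
applyσ ps U = foldl (λ W p → σ p W) U ps

applyσ⁻¹ : ∀ {k} → List ℕ → List (Word k) → List (Word k)
applyσ⁻¹ ps V = foldl (λ W p → σ⁻¹ p W) V ps

{-# OPTIONS --safe #-}
-- A single Hurwitz move σ_p on (a_1,…,a_ℓ) only rewrites the pair (a_p, a_{p+1})
-- into (a_{p+1}, a_{p+1}⁻¹ a_p a_{p+1}), and reversing a word commutes with
-- inverting it, so reversing every entry and the order of the tuple turns this
-- into the pair (a_{p+1}* a_p* (a_{p+1}*)⁻¹, a_{p+1}*) at positions ℓ−p, ℓ−p+1,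
-- which is exactly what σ⁻¹_{ℓ−p} produces. Hence the double reverse of σ_p A
-- is σ⁻¹_{ℓ−p} of the double reverse of A, already as words; since both moves
-- respect equality in G, the relation is preserved move by move.
module Submission where

open import Defs
open import Data.Nat using (ℕ; _≤_; _∸_; zero; suc; s≤s; z≤n)
open import Data.Product using (_×_; _,_)
open import Data.List using (List; length; map; []; _∷_; _++_; reverse)
open import Data.List.Properties
  using (++-assoc; ++-identityʳ; reverse-++; map-++; reverse-involutive; reverse-map;
         length-reverse; length-map; map-id; map-∘; map-cong)
open import Data.List.Relation.Unary.All using (All; []; _∷_)
open import Data.List.Relation.Binary.Pointwise using ([]; _∷_)
open import Data.List.Relation.Binary.Pointwise.Properties using (Pointwise-length)
open import Data.Bool.Properties using (not-involutive)
open import Relation.Binary.PropositionalEquality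
  using (_≡_; refl; sym; trans; cong; subst; module ≡-Reasoning)

module _ {k : ℕ} where

  flipL-involutive : (a : Letter k) → flipL (flipL a) ≡ a
  flipL-involutive (i , b) = cong (i ,_) (not-involutive b)

  inv-involutive : (w : Word k) → inv (inv w) ≡ w
  inv-involutive w = begin
    reverse (map flipL (reverse (map flipL w)))   ≡⟨ cong reverse (reverse-map flipL (map flipL w)) ⟩
    reverse (reverse (map flipL (map flipL w)))   ≡⟨ reverse-involutive _ ⟩
    map flipL (map flipL w)                       ≡⟨ map-∘ w ⟨
    map (λ a → flipL (flipL a)) w                 ≡⟨ map-cong flipL-involutive w ⟩
    map (λ a → a) w                               ≡⟨ map-id w ⟩
    w                                             ∎
    where open ≡-Reasoning

  inv-∷ : ∀ (a : Letter k) w → inv (a ∷ w) ≡ inv w ++ flipL a ∷ []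
  inv-∷ a w = reverse-++ (flipL a ∷ []) (map flipL w)

  rev-inv : (w : Word k) → rev (inv w) ≡ inv (rev w)
  rev-inv w = begin
    reverse (reverse (map flipL w))   ≡⟨ reverse-involutive _ ⟩
    map flipL w                       ≡⟨ reverse-involutive _ ⟨
    reverse (reverse (map flipL w))   ≡⟨ cong reverse (reverse-map flipL w) ⟨
    reverse (map flipL (reverse w))   ∎
    where open ≡-Reasoning

  rev-++₃ : (a b c : Word k) → rev (a ++ b ++ c) ≡ rev c ++ rev b ++ rev a
  rev-++₃ a b c = begin
    reverse (a ++ b ++ c)                   ≡⟨ reverse-++ a (b ++ c) ⟩
    reverse (b ++ c) ++ reverse a           ≡⟨ cong (_++ reverse a) (reverse-++ b c) ⟩
    (reverse c ++ reverse b) ++ reverse a   ≡⟨ ++-assoc (reverse c) (reverse b) (reverse a) ⟩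
    reverse c ++ reverse b ++ reverse a     ∎
    where open ≡-Reasoning

module WordCongruence {k : ℕ} (R : Word k → Set) where

  infix 4 _≈_
  _≈_ : Word k → Word k → Set₁
  u ≈ v = u ≈⟨ R ⟩ v

  open import Relation.Binary.Reasoning.Base.Single _≈_ ≈-refl ≈-trans

  ≡⇒≈ : ∀ {u v} → u ≡ v → u ≈ v
  ≡⇒≈ refl = ≈-refl

  ++-congˡ : ∀ w {u v} → u ≈ v → w ++ u ≈ w ++ v
  ++-congˡ w = ≈-cong ≈-refl

  ++-congʳ : ∀ w {u v} → u ≈ v → u ++ w ≈ v ++ w
  ++-congʳ w e = ≈-cong e ≈-refl

  inverseʳ : (w : Word k) → w ++ inv w ≈ []
  inverseʳ [] = ≈-refl
  inverseʳ (a ∷ w) = begin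
    a ∷ w ++ inv (a ∷ w)                ≡⟨ cong (λ z → a ∷ w ++ z) (inv-∷ a w) ⟩
    a ∷ w ++ inv w ++ flipL a ∷ []      ≡⟨ cong (a ∷_) (++-assoc w (inv w) _) ⟨
    a ∷ (w ++ inv w) ++ flipL a ∷ []    ∼⟨ ++-congˡ (a ∷ []) (++-congʳ (flipL a ∷ []) (inverseʳ w)) ⟩
    a ∷ flipL a ∷ []                    ∼⟨ ≈-cancel a ⟩
    []                                  ∎

  inverseˡ : (w : Word k) → inv w ++ w ≈ []
  inverseˡ w = subst (λ z → inv w ++ z ≈ []) (inv-involutive w) (inverseʳ (inv w))

  inv-cong : ∀ {u v} → u ≈ v → inv u ≈ inv v
  inv-cong {u} {v} u≈v = begin
    inv u                     ≡⟨ ++-identityʳ (inv u) ⟨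
    inv u ++ []               ∼⟨ ++-congˡ (inv u) (≈-sym (inverseʳ v)) ⟩
    inv u ++ v ++ inv v       ∼⟨ ++-congˡ (inv u) (++-congʳ (inv v) (≈-sym u≈v)) ⟩
    inv u ++ u ++ inv v       ≡⟨ ++-assoc (inv u) u (inv v) ⟨
    (inv u ++ u) ++ inv v     ∼⟨ ++-congʳ (inv v) (inverseˡ u) ⟩
    inv v                     ∎

  σ-cong : ∀ p {U V} → FactEq R U V → FactEq R (σ p U) (σ p V)
  σ-cong zero e = e
  σ-cong (suc zero) [] = []
  σ-cong (suc zero) (x ∷ []) = x ∷ []
  σ-cong (suc zero) (x ∷ y ∷ e) = y ∷ ≈-cong (inv-cong y) (≈-cong x y) ∷ e
  σ-cong (suc (suc i)) [] = []
  σ-cong (suc (suc i)) (x ∷ e) = x ∷ σ-cong (suc i) e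

  σ⁻¹-cong : ∀ p {U V} → FactEq R U V → FactEq R (σ⁻¹ p U) (σ⁻¹ p V)
  σ⁻¹-cong zero e = e
  σ⁻¹-cong (suc zero) [] = []
  σ⁻¹-cong (suc zero) (x ∷ []) = x ∷ []
  σ⁻¹-cong (suc zero) (x ∷ y ∷ e) = ≈-cong x (≈-cong y (inv-cong x)) ∷ x ∷ e
  σ⁻¹-cong (suc (suc i)) [] = []
  σ⁻¹-cong (suc (suc i)) (x ∷ e) = x ∷ σ⁻¹-cong (suc i) e

open WordCongruence using (σ-cong; σ⁻¹-cong)

module _ {k : ℕ} where

  length-σ : ∀ p (U : List (Word k)) → length (σ p U) ≡ length U
  length-σ zero U = refl
  length-σ (suc zero) [] = refl
  length-σ (suc zero) (x ∷ []) = refl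
  length-σ (suc zero) (x ∷ y ∷ U) = refl
  length-σ (suc (suc i)) [] = refl
  length-σ (suc (suc i)) (x ∷ U) = cong suc (length-σ (suc i) U)

  σ-at : ∀ (M : List (Word k)) x y rest →
    σ (suc (length M)) (M ++ x ∷ y ∷ rest) ≡ M ++ y ∷ (inv y ++ x ++ y) ∷ rest
  σ-at [] x y rest = refl
  σ-at (a ∷ M) x y rest = cong (a ∷_) (σ-at M x y rest)

  σ⁻¹-at : ∀ (M : List (Word k)) x y rest →
    σ⁻¹ (suc (length M)) (M ++ x ∷ y ∷ rest) ≡ M ++ (x ++ y ++ inv x) ∷ x ∷ rest
  σ⁻¹-at [] x y rest = refl
  σ⁻¹-at (a ∷ M) x y rest = cong (a ∷_) (σ⁻¹-at M x y rest)

  record SplitAt (A : List (Word k)) (p : ℕ) : Set where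
    field
      before : List (Word k)
      x y : Word k
      after : List (Word k)
      split : A ≡ before ++ x ∷ y ∷ after
      position : suc (length before) ≡ p
      mirrorPosition : length A ∸ p ≡ suc (length after)

  splitAt : ∀ (A : List (Word k)) p → 1 ≤ p → p ≤ length A ∸ 1 → SplitAt A p
  splitAt (x ∷ y ∷ A) (suc zero) _ _ = record
    { before = [] ; x = x ; y = y ; after = A
    ; split = refl ; position = refl ; mirrorPosition = refl }
  splitAt (a ∷ b ∷ A) (suc (suc p)) _ (s≤s p≤) =
    let s = splitAt (b ∷ A) (suc p) (s≤s z≤n) p≤
        open SplitAt s
    in record
      { before = a ∷ before ; x = x ; y = y ; after = after
      ; split = cong (a ∷_) split ; position = cong suc position
      ; mirrorPosition = mirrorPosition }

  doubleRev : List (Word k) → List (Word k)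
  doubleRev A = reverse (map rev A)

  length-doubleRev : (A : List (Word k)) → length (doubleRev A) ≡ length A
  length-doubleRev A = trans (length-reverse (map rev A)) (length-map rev A)

  doubleRev-split : ∀ (M : List (Word k)) x y N →
    doubleRev (M ++ x ∷ y ∷ N) ≡ doubleRev N ++ rev y ∷ rev x ∷ doubleRev M
  doubleRev-split M x y N = begin
    reverse (map rev (M ++ x ∷ y ∷ N))
      ≡⟨ cong reverse (map-++ rev M (x ∷ y ∷ N)) ⟩
    reverse (map rev M ++ rev x ∷ rev y ∷ map rev N)
      ≡⟨ reverse-++ (map rev M) (rev x ∷ rev y ∷ map rev N) ⟩
    reverse (rev x ∷ rev y ∷ map rev N) ++ doubleRev M
      ≡⟨ cong (_++ doubleRev M) (reverse-++ (rev x ∷ rev y ∷ []) (map rev N)) ⟩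
    (doubleRev N ++ rev y ∷ rev x ∷ []) ++ doubleRev M
      ≡⟨ ++-assoc (doubleRev N) (rev y ∷ rev x ∷ []) (doubleRev M) ⟩
    doubleRev N ++ rev y ∷ rev x ∷ doubleRev M
      ∎
    where open ≡-Reasoning

  σ⁻¹-doubleRev : ∀ (A : List (Word k)) p → 1 ≤ p → p ≤ length A ∸ 1 →
    σ⁻¹ (length A ∸ p) (doubleRev A) ≡ doubleRev (σ p A)
  σ⁻¹-doubleRev A p 1≤p p≤ with splitAt A p 1≤p p≤
  ... | record { before = M ; x = x ; y = y ; after = N
               ; split = refl ; position = refl ; mirrorPosition = ℓ∸p } = begin
    σ⁻¹ (length A ∸ p) (doubleRev A)
      ≡⟨ cong (λ q → σ⁻¹ q (doubleRev A)) ℓ∸p ⟩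
    σ⁻¹ (suc (length N)) (doubleRev A)
      ≡⟨ cong (σ⁻¹ (suc (length N))) (doubleRev-split M x y N) ⟩
    σ⁻¹ (suc (length N)) (doubleRev N ++ rev y ∷ rev x ∷ doubleRev M)
      ≡⟨ cong (λ n → σ⁻¹ (suc n) (doubleRev N ++ rev y ∷ rev x ∷ doubleRev M)) (length-doubleRev N) ⟨
    σ⁻¹ (suc (length (doubleRev N))) (doubleRev N ++ rev y ∷ rev x ∷ doubleRev M)
      ≡⟨ σ⁻¹-at (doubleRev N) (rev y) (rev x) (doubleRev M) ⟩
    doubleRev N ++ (rev y ++ rev x ++ inv (rev y)) ∷ rev y ∷ doubleRev M
      ≡⟨ cong (λ w → doubleRev N ++ w ∷ rev y ∷ doubleRev M) conjugate-rev ⟨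
    doubleRev N ++ rev (inv y ++ x ++ y) ∷ rev y ∷ doubleRev M
      ≡⟨ doubleRev-split M y (inv y ++ x ++ y) N ⟨
    doubleRev (M ++ y ∷ (inv y ++ x ++ y) ∷ N)
      ≡⟨ cong doubleRev (σ-at M x y N) ⟨
    doubleRev (σ p A)
      ∎
    where
      open ≡-Reasoning
      conjugate-rev : rev (inv y ++ x ++ y) ≡ rev y ++ rev x ++ inv (rev y)
      conjugate-rev = trans (rev-++₃ (inv y) x y) (cong (λ z → rev y ++ rev x ++ z) (rev-inv y))

  DoubleReverse-σ : ∀ (R : Word k → Set) ℓ {U V} → length U ≡ ℓ → DoubleReverse R U V →
    ∀ p → 1 ≤ p × p ≤ ℓ ∸ 1 → DoubleReverse R (σ p U) (σ⁻¹ (ℓ ∸ p) V)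
  DoubleReverse-σ R ℓ ∣U∣≡ℓ (A , U≈A , V≈A*) p (1≤p , p≤) =
    σ p A , σ-cong R p U≈A ,
    subst (FactEq R _) (mirror ∣A∣≡ℓ) (σ⁻¹-cong R (ℓ ∸ p) V≈A*)
    where
      ∣A∣≡ℓ : length A ≡ ℓ
      ∣A∣≡ℓ = trans (sym (Pointwise-length U≈A)) ∣U∣≡ℓ
      mirror : length A ≡ ℓ → σ⁻¹ (ℓ ∸ p) (doubleRev A) ≡ doubleRev (σ p A)
      mirror refl = σ⁻¹-doubleRev A p 1≤p p≤

  DoubleReverse-applyσ : ∀ (R : Word k → Set) ℓ {U V} → length U ≡ ℓ → DoubleReverse R U V →
    (ps : List ℕ) → All (λ p → 1 ≤ p × p ≤ ℓ ∸ 1) ps →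
    DoubleReverse R (applyσ ps U) (applyσ⁻¹ (map (λ p → ℓ ∸ p) ps) V)
  DoubleReverse-applyσ R ℓ ∣U∣≡ℓ UV [] [] = UV
  DoubleReverse-applyσ R ℓ {U} ∣U∣≡ℓ UV (p ∷ ps) (p-ok ∷ ps-ok) =
    DoubleReverse-applyσ R ℓ (trans (length-σ p U) ∣U∣≡ℓ) (DoubleReverse-σ R ℓ ∣U∣≡ℓ UV p p-ok) ps ps-ok

-- The hypothesis on the length of V is redundant: it follows from the double reverse relation.
lemma6p5 : ∀ {k : ℕ} (R : Word k → Set) (ℓ : ℕ) (U V : List (Word k))
    → length U ≡ ℓ → length V ≡ ℓ → DoubleReverse R U V
    → (ps : List ℕ) → All (λ p → 1 ≤ p × p ≤ ℓ ∸ 1) ps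
    → DoubleReverse R (applyσ ps U) (applyσ⁻¹ (map (λ p → ℓ ∸ p) ps) V)
lemma6p5 R ℓ U V ∣U∣≡ℓ _ = DoubleReverse-applyσ R ℓ ∣U∣≡ℓ
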